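{- For every two distinct $p,q\in S_\infty$ and every normal tree $T$ on $2\times\omega$, $j_{\mathcal L}(p,G_T)\ne j_{\mathcal L}(q,G_T)$.
   Context: $S_\infty$ is the group of permutations of $\omega$; $\mathcal L$ is the language with one binary relation symbol, and $j_{\mathcal L}$ is the logic action of $S_\infty$ on $\mathcal L$-structures with universe $\omega$: $j_{\mathcal L}(p,G)$ has $p(n)$ related to $p(m)$ iff $n$ is related to $m$ in $G$. A normal tree on $2\times\omega$ is a set $T$ of pairs $(u,s)$ with $u\in{}^{<\omega}2$, $s\in{}^{<\omega}\omega$, $|u|=|s|$, closed under taking initial segments, such that $(u,s)\in T$ and $s\le t$ pointwise with $|t|=|s|$ imply $(u,t)\in T$. Fix a bijection $\#\colon{}^{<\omega}\omega\to\omega$ and a bijection $\theta\colon{}^{<\omega}2\to\omega$ with $|u|<|v|\Rightarrow\theta(u)<\theta(v)$. Let $G_0$ be the combinatorial tree obtained from ${}^{<\omega}\omega$ by inserting, for each $s\ne\emptyset$, a new vertex $s^*$ between $s\restriction(|s|-1)$ and $s$. Let $G_1$ be obtained from $G_0$ by adding, for each $s$, vertices $s^+, s^{++}$ and $(s^{++},i,j)$ for $0\le j\le i\le \#s+2$, with edges $s - s^+$, $s^+ - s^{++}$, $s^{++} - (s^{++},i,0)$, $(s^{++},i,j) - (s^{++},i,j+1)$. For a normal tree $T$, $G_T$ is obtained from $G_1$ by adding, for each $(u,s)\in T$, vertices $(u,s,x)$ where $x$ is an initial segment of $0^{2\theta(u)+4}$ or $x=0^{2\theta(u)+2}{}^\frown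 1$, with edges $(u,s,\emptyset) - s$ and $(u,s,x)-(u,s,x')$ whenever one of $x,x'$ is an immediate successor of the other. $G_T$ is regarded as an $\mathcal L$-structure with universe $\omega$ via a fixed coding (Borel in $T$) of its vertex set by $\omega$. -}

module Defs where

open import Data.Nat using (ℕ; zero; suc; _+_; _*_; _≤_; _<_)
open import Data.Bool using (Bool; true)
open import Data.List using (List; []; _∷_; _∷ʳ_; length; take)
open import Data.List.Relation.Binary.Pointwise using (Pointwise)
open import Data.Sum using (_⊎_)
open import Data.Product using (_×_)
open import Function.Bundles using (_↔_; Inverse; _⇔_)
open import Relation.Binary.PropositionalEquality using (_≡_)

S∞ : Set
S∞ = ℕ ↔ ℕ

-- an 𝓛-structure with universe ω (one binary relation symbol)
Structure : Set₁
Structure = ℕ → ℕ → Set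

-- logic action: p(n) R' p(m) iff n R m, i.e. R'(a,b) = R(p⁻¹ a, p⁻¹ b)
jL : S∞ → Structure → Structure
jL p R a b = R (Inverse.from p a) (Inverse.from p b)

SameStructure : Structure → Structure → Set
SameStructure R R' = ∀ a b → R a b ⇔ R' a b

SamePerm : S∞ → S∞ → Set
SamePerm p q = ∀ n → Inverse.to p n ≡ Inverse.to q n

-- ^{<ω}2 = List Bool, ^{<ω}ω = List ℕ.
-- A set of pairs (u,s) is given by its (Bool-valued) characteristic function.
record NormalTree : Set where
  field
    mem      : List Bool → List ℕ → Bool
    lenEq    : ∀ {u s} → mem u s ≡ true → length u ≡ length s
    prefix   : ∀ {u s} → mem u s ≡ true → ∀ k → mem (take k u) (take k s) ≡ true
    monotone : ∀ {u s t} → mem u s ≡ true → Pointwise _≤_ s t → mem u t ≡ true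
open NormalTree public

LengthMonotone : (List Bool ↔ ℕ) → Set
LengthMonotone θ = ∀ u v → length u < length v → Inverse.to θ u < Inverse.to θ v

module _ (hash : List ℕ ↔ ℕ) (θ : List Bool ↔ ℕ) (T : NormalTree) where

  private
    #_ : List ℕ → ℕ
    # s = Inverse.to hash s
    θ′ : List Bool → ℕ
    θ′ u = Inverse.to θ u

  data Vertex : Set where
    node   : List ℕ → Vertex
    star   : List ℕ → ℕ → Vertex                      -- (s⁀n)* between s and s⁀n
    plus   : List ℕ → Vertex
    plus2  : List ℕ → Vertex
    ladder : (s : List ℕ) (i j : ℕ) → j ≤ i → i ≤ # s + 2 → Vertex
    leaf   : (u : List Bool) (s : List ℕ) → mem T u s ≡ true →
             (k : ℕ) → k ≤ 2 * θ′ u + 4 → Vertex     -- (u,s,0^k)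
    leafOne : (u : List Bool) (s : List ℕ) → mem T u s ≡ true → Vertex
                                                       -- (u,s,0^{2θ(u)+2}⁀1)

  data Basic : Vertex → Vertex → Set where
    e-star₁  : ∀ s n → Basic (node s) (star s n)
    e-star₂  : ∀ s n → Basic (star s n) (node (s ∷ʳ n))
    e-plus   : ∀ s → Basic (node s) (plus s)
    e-plus2  : ∀ s → Basic (plus s) (plus2 s)
    e-lad₀   : ∀ s i p q → Basic (plus2 s) (ladder s i 0 p q)
    e-lad    : ∀ s i j p p′ q q′ → Basic (ladder s i j p q) (ladder s i (suc j) p′ q′)
    e-root   : ∀ u s m b → Basic (leaf u s m 0 b) (node s)
    e-leaf   : ∀ u s m m′ k b b′ → Basic (leaf u s m k b) (leaf u s m′ (suc k) b′)
    e-one    : ∀ u s m m′ b → Basic (leaf u s m (2 * θ′ u + 2) b) (leafOne u s m′)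

  Edge : Vertex → Vertex → Set
  Edge a b = Basic a b ⊎ Basic b a

  G : (ℕ ↔ Vertex) → Structure
  G c n m = Edge (Inverse.to c n) (Inverse.to c m)

module Submission where

-- The graphs G_T are rigid, hence S∞ acts freely on their codes.
--
-- If j(p, G) = j(q, G) then q⁻¹ ∘ p is an automorphism of G, so for a RIGID
-- structure G it is the identity and p = q.  Rigidity is invariant under
-- recoding the universe along a bijection, so it suffices to show that the
-- graph G_T on its natural vertex type has no automorphism other than the
-- identity.

open import Defs
open import Data.Nat using (ℕ)
open import Data.Bool using (Bool)
open import Data.List using (List)
open import Function.Bundles using (_↔_)
open import Relation.Nullary using (¬_)

open import Axiom.UniquenessOfIdentityProofs.WithK using (uip)
open import Data.Bool using (true)
open import Data.Empty using (⊥; ⊥-elim)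
open import Data.Fin using (Fin; zero; suc; toℕ)
open import Data.Fin.Properties using (toℕ-injective; toℕ≤pred[n]; injective⇒≤)
open import Data.List using ([]; _∷_; _∷ʳ_; _++_; [_])
open import Data.List.Properties using (++-assoc; ++-identityʳ-unique; ∷ʳ-injectiveʳ)
open import Data.Nat using (zero; suc; _+_; _*_; _≤_; z≤n; s≤s)
open import Data.Nat.Properties
  using (≤-refl; ≤-trans; ≤-antisym; ≤-irrelevant; <⇒≤; m≤n+m; m≤n⇒m<n∨m≡n;
         +-monoʳ-≤; +-cancelʳ-≤; *-cancelˡ-≤; *-distribˡ-+; even≢odd)
open import Data.Product using (Σ; _×_; _,_; proj₁; proj₂)
open import Data.Sum using (_⊎_; inj₁; inj₂; map₂)
open import Function.Bundles using (Inverse; Injection; Equivalence; _⇔_; mk⇔)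
open import Function.Definitions using (Injective)
open import Function.Properties.Inverse using (↔-sym; ↔-trans; ↔⇒↣)
open import Relation.Binary.PropositionalEquality
  using (_≡_; _≢_; refl; sym; trans; cong; cong₂; subst; subst₂; module ≡-Reasoning)
open import Relation.Nullary using (contradiction)

↔-injective : ∀ {A B : Set} (f : A ↔ B) {a b : A} →
              Inverse.to f a ≡ Inverse.to f b → a ≡ b
↔-injective f = Injection.injective (↔⇒↣ f)

⇔-substˡ : ∀ {A : Set} (R : A → A → Set) {a a′ b b′ : A} {X : Set} →
           a ≡ a′ → b ≡ b′ → R a b ⇔ X → R a′ b′ ⇔ X
⇔-substˡ R {X = X} = subst₂ (λ x y → R x y ⇔ X)

-- 1. Automorphisms of a binary relation and their invariants

module Graph {A : Set} (R : A → A → Set) where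

  record Automorphism : Set where
    field
      perm      : A ↔ A
      preserves : ∀ a b → R a b ⇔ R (Inverse.to perm a) (Inverse.to perm b)

    open Inverse perm public using (to; from; strictlyInverseˡ; strictlyInverseʳ)

    injective : ∀ {a b} → to a ≡ to b → a ≡ b
    injective = ↔-injective perm

    maps : ∀ {a b} → R a b → R (to a) (to b)
    maps {a} {b} = Equivalence.to (preserves a b)

    maps≡ : ∀ {a b a′ b′} → to a ≡ a′ → to b ≡ b′ → R a b → R a′ b′
    maps≡ ea eb r = subst₂ R ea eb (maps r)

    reflects : ∀ {a b} → R (to a) (to b) → R a b
    reflects {a} {b} = Equivalence.from (preserves a b)

    reflects-from : ∀ {a w} → R (to a) w → R a (from w)
    reflects-from {a} {w} r = reflects (subst (R (to a)) (sym (strictlyInverseˡ w)) r)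

    fixed-neighbour : ∀ {x y} → to y ≡ y → R y x →
                      (∀ {w} → R y w → w ≡ x ⊎ to w ≡ w) → to x ≡ x
    fixed-neighbour fy e others with others (maps≡ fy refl e)
    ... | inj₁ tx≡x  = tx≡x
    ... | inj₂ ttx≡tx = injective ttx≡tx

  open Automorphism

  _⁻¹ : Automorphism → Automorphism
  F ⁻¹ = record
    { perm      = ↔-sym (perm F)
    ; preserves = λ a b → mk⇔
        (λ r → reflects F (subst₂ R (sym (strictlyInverseˡ F a)) (sym (strictlyInverseˡ F b)) r))
        (λ r → subst₂ R (strictlyInverseˡ F a) (strictlyInverseˡ F b) (maps F r))
    }

  inverse-maps : (F : Automorphism) {a b : A} → to F a ≡ b → to (F ⁻¹) b ≡ a
  inverse-maps F {a} eq = trans (cong (from F) (sym eq)) (strictlyInverseʳ F a)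

  Rigid : Set
  Rigid = (F : Automorphism) → ∀ a → to F a ≡ a

  Invariant : (A → Set) → Set
  Invariant P = (F : Automorphism) → ∀ {v} → P v → P (to F v)

  reflect : ∀ {P} → Invariant P → (F : Automorphism) → ∀ {v} → P (to F v) → P v
  reflect {P} inv F {v} p = subst P (strictlyInverseʳ F v) (inv (F ⁻¹) p)

  Deg1 : A → Set
  Deg1 v = Σ A λ w → R v w × (∀ {w′} → R v w′ → w′ ≡ w)

  AtLeast : ℕ → A → Set
  AtLeast n v = Σ (Fin n → A) λ f → (∀ k → R v (f k)) × Injective _≡_ _≡_ f

  HasPendant : A → Set
  HasPendant v = Σ A λ w → R v w × Deg1 w

  -- in G_T these are exactly the vertices s⁺⁺
  Hub : A → Set
  Hub v = AtLeast 4 v × HasPendant v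

  Bridge : A → Set
  Bridge v = Σ A λ a → Σ A λ b →
    R v a × R v b × a ≢ b × AtLeast 4 a × AtLeast 4 b

  deg1-invariant : Invariant Deg1
  deg1-invariant F (w , e , unique) =
    to F w , maps F e ,
    λ {w′} e′ → trans (sym (strictlyInverseˡ F w′)) (cong (to F) (unique (reflects-from F e′)))

  atLeast-invariant : ∀ {n} → Invariant (AtLeast n)
  atLeast-invariant F (f , adjacent , inj) =
    (λ k → to F (f k)) , (λ k → maps F (adjacent k)) , (λ eq → inj (injective F eq))

  hub-invariant : Invariant Hub
  hub-invariant F (big , w , e , pendant) =
    atLeast-invariant F big , to F w , maps F e , deg1-invariant F pendant

  bridge-invariant : Invariant Bridge
  bridge-invariant F (a , b , ea , eb , a≢b , big-a , big-b) =
    to F a , to F b , maps F ea , maps F eb , (λ eq → a≢b (injective F eq)) ,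
    atLeast-invariant F big-a , atLeast-invariant F big-b

  two-neighbours-not-deg1 : ∀ {v a b} → R v a → R v b → a ≢ b → ¬ Deg1 v
  two-neighbours-not-deg1 ea eb a≢b (w , _ , unique) = a≢b (trans (unique ea) (sym (unique eb)))

  Subsingleton : (A → Set) → Set
  Subsingleton P = ∀ {w w′} → P w → P w′ → w ≡ w′

  point : ∀ {a} → Subsingleton (_≡ a)
  point refl refl = refl

  at-most-three : ∀ {v} {P Q S : A → Set} → (∀ {w} → R v w → P w ⊎ Q w ⊎ S w) →
                  Subsingleton P → Subsingleton Q → Subsingleton S → ¬ AtLeast 4 v
  at-most-three {P = P} {Q} {S} classify sub-P sub-Q sub-S (f , adjacent , inj) =
    4≰3 (injective⇒≤ {f = tag} tag-injective)
    where
    class : ∀ {w} → P w ⊎ Q w ⊎ S w → Fin 3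
    class (inj₁ _)        = zero
    class (inj₂ (inj₁ _)) = suc zero
    class (inj₂ (inj₂ _)) = suc (suc zero)

    same-class : ∀ {w w′} (x : P w ⊎ Q w ⊎ S w) (y : P w′ ⊎ Q w′ ⊎ S w′) →
                 class x ≡ class y → w ≡ w′
    same-class (inj₁ x)        (inj₁ y)        _ = sub-P x y
    same-class (inj₂ (inj₁ x)) (inj₂ (inj₁ y)) _ = sub-Q x y
    same-class (inj₂ (inj₂ x)) (inj₂ (inj₂ y)) _ = sub-S x y
    same-class (inj₁ _)        (inj₂ (inj₁ _)) ()
    same-class (inj₁ _)        (inj₂ (inj₂ _)) ()
    same-class (inj₂ (inj₁ _)) (inj₁ _)        ()
    same-class (inj₂ (inj₁ _)) (inj₂ (inj₂ _)) ()
    same-class (inj₂ (inj₂ _)) (inj₁ _)        ()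
    same-class (inj₂ (inj₂ _)) (inj₂ (inj₁ _)) ()

    tag : Fin 4 → Fin 3
    tag k = class (classify (adjacent k))

    tag-injective : Injective _≡_ _≡_ tag
    tag-injective {k} {k′} eq = inj (same-class (classify (adjacent k)) (classify (adjacent k′)) eq)

    4≰3 : ¬ 4 ≤ 3
    4≰3 (s≤s (s≤s (s≤s ())))

  at-most-two : ∀ {v} {P Q : A → Set} → (∀ {w} → R v w → P w ⊎ Q w) →
                Subsingleton P → Subsingleton Q → ¬ AtLeast 4 v
  at-most-two classify sub-P sub-Q =
    at-most-three {S = λ _ → ⊥} (λ e → map₂ inj₁ (classify e)) sub-P sub-Q (λ ())

-- 2. Rigidity, recoding and the logic action

-- Rigidity survives recoding the universe along a bijection c: an
-- automorphism F of the recoded relation conjugates to c ∘ F ∘ c⁻¹.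
rigid-recode : ∀ {A B : Set} (R : A → A → Set) (c : B ↔ A) →
  Graph.Rigid R → Graph.Rigid (λ x y → R (Inverse.to c x) (Inverse.to c y))
rigid-recode R c rigid F x = ↔-injective c (begin
    to (F.to x)             ≡⟨ cong (λ y → to (F.to y)) (sym (strictlyInverseʳ x)) ⟩
    to (F.to (from (to x))) ≡⟨ rigid conjugate (to x) ⟩
    to x                    ∎)
  where
  open Inverse c using (to; from; strictlyInverseˡ; strictlyInverseʳ)
  open ≡-Reasoning
  module F = Graph.Automorphism F

  conjugate : Graph.Automorphism R
  conjugate = record
    { perm      = ↔-trans (↔-sym c) (↔-trans F.perm c)
    ; preserves = λ a b → ⇔-substˡ R (strictlyInverseˡ a) (strictlyInverseˡ b)
                                      (F.preserves (from a) (from b))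
    }

-- If j(p, R) = j(q, R) then q⁻¹ ∘ p is an automorphism of R; for rigid R
-- this forces p = q.
rigid⇒free : (R : Structure) → Graph.Rigid R → (p q : S∞) →
             SameStructure (jL p R) (jL q R) → SamePerm p q
rigid⇒free R rigid p q same n = begin
  P.to n                   ≡⟨ sym (Q.strictlyInverseˡ (P.to n)) ⟩
  Q.to (Q.from (P.to n))   ≡⟨ cong Q.to (rigid q⁻¹p n) ⟩
  Q.to n                   ∎
  where
  module P = Inverse p
  module Q = Inverse q
  open ≡-Reasoning

  q⁻¹p : Graph.Automorphism R
  q⁻¹p = record
    { perm      = ↔-trans p (↔-sym q)
    ; preserves = λ a b → ⇔-substˡ R (P.strictlyInverseʳ a) (P.strictlyInverseʳ b)
                                      (same (P.to a) (P.to b))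
    }

-- 3. The local structure of G_T

module Structure (hash : List ℕ ↔ ℕ) (θ : List Bool ↔ ℕ) (T : NormalTree) where

  V : Set
  V = Vertex hash θ T

  E : V → V → Set
  E = Edge hash θ T

  open Graph E public

  #_ : List ℕ → ℕ
  # s = Inverse.to hash s

  θ′ : List Bool → ℕ
  θ′ u = Inverse.to θ u

  -- the leaf path of (u,s) has vertices 0^k for k ≤ top u and forks at fork u
  top fork : List Bool → ℕ
  top u  = 2 * θ′ u + 4
  fork u = 2 * θ′ u + 2

  fork≤top : ∀ u → fork u ≤ top u
  fork≤top u = +-monoʳ-≤ (2 * θ′ u) (s≤s (s≤s z≤n))

  ladder-≡ : ∀ {s i i′ j j′ p p′ q q′} → i ≡ i′ → j ≡ j′ →
             _≡_ {A = V} (ladder s i j p q) (ladder s i′ j′ p′ q′)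
  ladder-≡ {p = p} {p′} {q} {q′} refl refl = cong₂ (ladder _ _ _) (≤-irrelevant p p′) (≤-irrelevant q q′)

  leaf-≡ : ∀ {u u′ s m m′ k k′ b b′} → u ≡ u′ → k ≡ k′ →
           _≡_ {A = V} (leaf u s m k b) (leaf u′ s m′ k′ b′)
  leaf-≡ {m = m} {m′} {b = b} {b′} refl refl = cong₂ (λ m b → leaf _ _ m _ b) (uip m m′) (≤-irrelevant b b′)

  leafOne-≡ : ∀ {u s m m′} → _≡_ {A = V} (leafOne u s m) (leafOne u s m′)
  leafOne-≡ = cong (leafOne _ _) (uip _ _)

  node-injective : ∀ {s t} → _≡_ {A = V} (node s) (node t) → s ≡ t
  node-injective refl = refl

  extension-≢ : ∀ (s : List ℕ) x xs → s ++ (x ∷ xs) ≢ s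
  extension-≢ s x xs eq with ++-identityʳ-unique s (sym eq)
  ... | ()

  node-≢-child : ∀ {s n} → _≡_ {A = V} (node (s ∷ʳ n)) (node s) → ⊥
  node-≢-child {s} {n} eq = extension-≢ s n [] (node-injective eq)

  node-≢-grandchild : ∀ {s n n′} → _≡_ {A = V} (node ((s ∷ʳ n) ∷ʳ n′)) (node s) → ⊥
  node-≢-grandchild {s} {n} {n′} eq =
    extension-≢ s n [ n′ ] (trans (sym (++-assoc s [ n ] [ n′ ])) (node-injective eq))

  ladderDown : ∀ s i j → j ≤ i → i ≤ # s + 2 → V
  ladderDown s i zero    _ _ = plus2 s
  ladderDown s i (suc j) p q = ladder s i j (<⇒≤ p) q

  leafDown : ∀ u s → mem T u s ≡ true → ∀ k → k ≤ top u → V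
  leafDown u s m zero    _ = node s
  leafDown u s m (suc k) b = leaf u s m k (<⇒≤ b)

  ladder-up≢down : ∀ {s i j p p′ q} → ladder s i (suc j) p q ≢ ladderDown s i j p′ q
  ladder-up≢down {j = zero}  ()
  ladder-up≢down {j = suc j} ()

  leaf-up≢down : ∀ {u s m k b b′} → leaf u s m (suc k) b ≢ leafDown u s m k b′
  leaf-up≢down {k = zero}  ()
  leaf-up≢down {k = suc k} ()

  leaf-down-edge : ∀ {u s m k b} → E (leaf u s m k b) (leafDown u s m k b)
  leaf-down-edge {u} {s} {m} {zero}  {b} = inj₁ (e-root u s m b)
  leaf-down-edge {u} {s} {m} {suc k} {b} = inj₂ (e-leaf u s m m k (<⇒≤ b) b)

  nbr-node : ∀ {t w} → E (node t) w →
    (Σ (List ℕ) λ s → Σ ℕ λ n → w ≡ star s n) ⊎ w ≡ plus t ⊎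
    (Σ (List Bool) λ u → Σ (mem T u t ≡ true) λ m → w ≡ leaf u t m 0 z≤n)
  nbr-node (inj₁ (e-star₁ s n))         = inj₁ (s , n , refl)
  nbr-node (inj₁ (e-plus s))            = inj₂ (inj₁ refl)
  nbr-node (inj₂ (e-star₂ s n))         = inj₁ (s , n , refl)
  nbr-node (inj₂ (e-root u s m z≤n))    = inj₂ (inj₂ (u , m , refl))

  nbr-star : ∀ {s n w} → E (star s n) w → w ≡ node s ⊎ w ≡ node (s ∷ʳ n)
  nbr-star (inj₁ (e-star₂ s n)) = inj₂ refl
  nbr-star (inj₂ (e-star₁ s n)) = inj₁ refl

  nbr-plus : ∀ {s w} → E (plus s) w → w ≡ node s ⊎ w ≡ plus2 s
  nbr-plus (inj₁ (e-plus2 s)) = inj₂ refl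
  nbr-plus (inj₂ (e-plus s))  = inj₁ refl

  nbr-plus2 : ∀ {s w} → E (plus2 s) w →
    w ≡ plus s ⊎ (Σ ℕ λ i → Σ (i ≤ # s + 2) λ q → w ≡ ladder s i 0 z≤n q)
  nbr-plus2 (inj₁ (e-lad₀ s i z≤n q)) = inj₂ (i , q , refl)
  nbr-plus2 (inj₂ (e-plus2 s))        = inj₁ refl

  nbr-ladder : ∀ {s i j p q w} → E (ladder s i j p q) w →
    w ≡ ladderDown s i j p q ⊎ (Σ (suc j ≤ i) λ p′ → w ≡ ladder s i (suc j) p′ q)
  nbr-ladder (inj₁ (e-lad s i j p p′ q q′)) = inj₂ (p′ , ladder-≡ refl refl)
  nbr-ladder (inj₂ (e-lad₀ s i p q))        = inj₁ refl
  nbr-ladder (inj₂ (e-lad s i j p p′ q q′)) = inj₁ (ladder-≡ refl refl)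

  nbr-leaf : ∀ {u s m k b w} → E (leaf u s m k b) w →
    w ≡ leafDown u s m k b ⊎ (Σ (suc k ≤ top u) λ b′ → w ≡ leaf u s m (suc k) b′) ⊎
    (k ≡ fork u × w ≡ leafOne u s m)
  nbr-leaf (inj₁ (e-root u s m b))           = inj₁ refl
  nbr-leaf (inj₁ (e-leaf u s m m′ k b b′))   = inj₂ (inj₁ (b′ , leaf-≡ refl refl))
  nbr-leaf (inj₁ (e-one u s m m′ b))         = inj₂ (inj₂ (refl , leafOne-≡))
  nbr-leaf (inj₂ (e-leaf u s m m′ k b b′))   = inj₁ (leaf-≡ refl refl)

  nbr-leafOne : ∀ {u s m w} → E (leafOne u s m) w → w ≡ leaf u s m (fork u) (fork≤top u)
  nbr-leafOne (inj₂ (e-one u s m m′ b)) = leaf-≡ refl refl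

  node-big : ∀ {s} → AtLeast 4 (node s)
  node-big {s} = (λ k → star s (toℕ k)) , (λ k → inj₁ (e-star₁ s (toℕ k))) ,
                 λ eq → toℕ-injective (star-label eq)
    where
    star-label : ∀ {a b} → _≡_ {A = V} (star s a) (star s b) → a ≡ b
    star-label refl = refl

  plus2-big : ∀ {s} → AtLeast 4 (plus2 s)
  plus2-big {s} = arm , adjacent , injective
    where
    rung-bound : (k : Fin 3) → toℕ k ≤ # s + 2
    rung-bound k = ≤-trans (toℕ≤pred[n] k) (m≤n+m 2 (# s))

    arm : Fin 4 → V
    arm zero    = plus s
    arm (suc k) = ladder s (toℕ k) 0 z≤n (rung-bound k)

    adjacent : ∀ k → E (plus2 s) (arm k)
    adjacent zero    = inj₂ (e-plus2 s)
    adjacent (suc k) = inj₁ (e-lad₀ s (toℕ k) z≤n (rung-bound k))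

    injective : Injective _≡_ _≡_ arm
    injective {zero}  {zero}  _    = refl
    injective {suc k} {suc l} eq   = cong suc (toℕ-injective (rung-index eq))
      where
      rung-index : ∀ {a b x y} → _≡_ {A = V} (ladder s a 0 z≤n x) (ladder s b 0 z≤n y) → a ≡ b
      rung-index refl = refl
    injective {zero}  {suc _} ()
    injective {suc _} {zero}  ()

  star-small : ∀ {s n} → ¬ AtLeast 4 (star s n)
  star-small = at-most-two nbr-star point point

  plus-small : ∀ {s} → ¬ AtLeast 4 (plus s)
  plus-small = at-most-two nbr-plus point point

  ladder-small : ∀ {s i j p q} → ¬ AtLeast 4 (ladder s i j p q)
  ladder-small = at-most-two nbr-ladder point λ { (_ , refl) (_ , refl) → ladder-≡ refl refl }

  leaf-small : ∀ {u s m k b} → ¬ AtLeast 4 (leaf u s m k b)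
  leaf-small = at-most-three nbr-leaf point
    (λ { (_ , refl) (_ , refl) → leaf-≡ refl refl }) (λ { (_ , refl) (_ , refl) → refl })

  leafOne-small : ∀ {u s m} → ¬ AtLeast 4 (leafOne u s m)
  leafOne-small = at-most-two {Q = λ _ → ⊥} (λ e → inj₁ (nbr-leafOne e)) point λ ()

  first-rung-pendant : ∀ {s q} → Deg1 (ladder s 0 0 z≤n q)
  first-rung-pendant {s} {q} = plus2 s , inj₂ (e-lad₀ s 0 z≤n q) , only-plus2
    where
    only-plus2 : ∀ {w} → E (ladder s 0 0 z≤n q) w → w ≡ plus2 s
    only-plus2 e with nbr-ladder e
    ... | inj₁ eq      = eq
    ... | inj₂ (() , _)

  leafOne-pendant : ∀ {u s m} → Deg1 (leafOne u s m)
  leafOne-pendant {u} {s} {m} =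
    leaf u s m (fork u) (fork≤top u) , inj₂ (e-one u s m m (fork≤top u)) , nbr-leafOne

  pendant-leaf-at-top : ∀ {u s m k b} → Deg1 (leaf u s m k b) → k ≡ top u
  pendant-leaf-at-top {u} {s} {m} {k} {b} pendant with m≤n⇒m<n∨m≡n b
  ... | inj₂ k≡top = k≡top
  ... | inj₁ k<top = ⊥-elim (two-neighbours-not-deg1 leaf-down-edge
                              (inj₁ (e-leaf u s m m k b k<top)) (λ eq → leaf-up≢down (sym eq)) pendant)

  node-has-no-pendant : ∀ {t} → ¬ HasPendant (node t)
  node-has-no-pendant {t} (w , e , pendant) with nbr-node e
  ... | inj₁ (s , n , refl) =
    two-neighbours-not-deg1 (inj₂ (e-star₁ s n)) (inj₁ (e-star₂ s n)) (λ eq → node-≢-child (sym eq)) pendant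
  ... | inj₂ (inj₁ refl) =
    two-neighbours-not-deg1 (inj₂ (e-plus t)) (inj₁ (e-plus2 t)) (λ ()) pendant
  ... | inj₂ (inj₂ (u , m , refl)) =
    two-neighbours-not-deg1 (inj₁ (e-root u t m z≤n))
      (inj₁ (e-leaf u t m m 0 z≤n (≤-trans (s≤s z≤n) (m≤n+m 4 (2 * θ′ u))))) (λ ()) pendant

  plus2-hub : ∀ {s} → Hub (plus2 s)
  plus2-hub {s} = plus2-big , ladder s 0 0 z≤n z≤n , inj₁ (e-lad₀ s 0 z≤n z≤n) , first-rung-pendant

  hub-is-plus2 : ∀ v → Hub v → Σ (List ℕ) λ s → v ≡ plus2 s
  hub-is-plus2 (node _)           (_ , pendant) = ⊥-elim (node-has-no-pendant pendant)
  hub-is-plus2 (star _ _)         (big , _)     = ⊥-elim (star-small big)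
  hub-is-plus2 (plus _)           (big , _)     = ⊥-elim (plus-small big)
  hub-is-plus2 (plus2 s)          _             = s , refl
  hub-is-plus2 (ladder _ _ _ _ _) (big , _)     = ⊥-elim (ladder-small big)
  hub-is-plus2 (leaf _ _ _ _ _)   (big , _)     = ⊥-elim (leaf-small big)
  hub-is-plus2 (leafOne _ _ _)    (big , _)     = ⊥-elim (leafOne-small big)

  plus-bridge : ∀ {s} → Bridge (plus s)
  plus-bridge {s} = node s , plus2 s , inj₂ (e-plus s) , inj₁ (e-plus2 s) , (λ ()) , node-big , plus2-big

  rung0-not-bridge : ∀ {s i q} → ¬ Bridge (ladder s i 0 z≤n q)
  rung0-not-bridge {s} (a , b , ea , eb , a≢b , big-a , big-b) =
    a≢b (trans (big-is-plus2 ea big-a) (sym (big-is-plus2 eb big-b)))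
    where
    big-is-plus2 : ∀ {i q w} → E (ladder s i 0 z≤n q) w → AtLeast 4 w → w ≡ plus2 s
    big-is-plus2 e big with nbr-ladder e
    ... | inj₁ eq         = eq
    ... | inj₂ (_ , refl) = ⊥-elim (ladder-small big)

  star-unique : ∀ {s n w} → E (node s) w → E w (node (s ∷ʳ n)) → w ≡ star s n
  star-unique {s} (inj₁ (e-star₁ s n′)) e with nbr-star e
  ... | inj₁ eq = ⊥-elim (node-≢-child eq)
  ... | inj₂ eq = cong (star s) (sym (∷ʳ-injectiveʳ s s (node-injective eq)))
  star-unique (inj₁ (e-plus s)) e with nbr-plus e
  ... | inj₁ eq = ⊥-elim (node-≢-child eq)
  ... | inj₂ ()
  star-unique (inj₂ (e-star₂ s n′)) e with nbr-star e
  ... | inj₁ eq = ⊥-elim (node-≢-grandchild eq)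
  ... | inj₂ eq = ⊥-elim (node-≢-child eq)
  star-unique (inj₂ (e-root u s m b)) e with nbr-leaf e
  ... | inj₁ eq                 = ⊥-elim (node-≢-child eq)
  ... | inj₂ (inj₁ (_ , ()))
  ... | inj₂ (inj₂ (_ , ()))

-- 4. Rigidity of G_T

odd≢even : ∀ a b → suc (2 * a + 2) ≢ 2 * b + 4
odd≢even a b eq = even≢odd (b + 2) (a + 1)
  (trans (*-distribˡ-+ 2 b 2) (trans (sym eq) (cong suc (sym (*-distribˡ-+ 2 a 1)))))

module Rigidity (hash : List ℕ ↔ ℕ) (θ : List Bool ↔ ℕ) (T : NormalTree) where

  open Structure hash θ T
  open Automorphism

  module Tracking (F : Automorphism) where

    plus2-image : ∀ s → Σ (List ℕ) λ s′ → to F (plus2 s) ≡ plus2 s′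
    plus2-image s = hub-is-plus2 _ (hub-invariant F plus2-hub)

    -- the first rung of a ladder at s⁺⁺ goes to a first rung at F(s⁺⁺),
    -- not to s′⁺, since s′⁺ is a bridge
    rung0-image : ∀ {s s′} → to F (plus2 s) ≡ plus2 s′ → ∀ i q →
      Σ ℕ λ i′ → Σ (i′ ≤ # s′ + 2) λ q′ → to F (ladder s i 0 z≤n q) ≡ ladder s′ i′ 0 z≤n q′
    rung0-image {s} hub i q with nbr-plus2 (maps≡ F hub refl (inj₁ (e-lad₀ s i z≤n q)))
    ... | inj₂ image = image
    ... | inj₁ to≡plus =
      ⊥-elim (rung0-not-bridge (reflect bridge-invariant F (subst Bridge (sym to≡plus) plus-bridge)))

    ladder-track : ∀ {s s′ i i′ q q′} → to F (plus2 s) ≡ plus2 s′ →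
      to F (ladder s i 0 z≤n q) ≡ ladder s′ i′ 0 z≤n q′ →
      ∀ j (p : j ≤ i) → Σ (j ≤ i′) λ p′ →
        to F (ladderDown s i j p q) ≡ ladderDown s′ i′ j p′ q′ × to F (ladder s i j p q) ≡ ladder s′ i′ j p′ q′
    ladder-track hub rung0 zero z≤n = z≤n , hub , rung0
    ladder-track {s} {i = i} {q = q} hub rung0 (suc j) p with ladder-track hub rung0 j (<⇒≤ p)
    ... | p′ , down , here with nbr-ladder (maps≡ F here refl (inj₁ (e-lad s i j (<⇒≤ p) p q q)))
    ...   | inj₁ up↦down     = ⊥-elim (ladder-up≢down (injective F (trans up↦down (sym down))))
    ...   | inj₂ (p″ , up↦up) = p″ , trans here (ladder-≡ refl refl) , up↦up

    arm-length : ∀ {s s′ i i′ q q′} → to F (plus2 s) ≡ plus2 s′ →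
      to F (ladder s i 0 z≤n q) ≡ ladder s′ i′ 0 z≤n q′ → i ≤ i′
    arm-length hub rung0 = proj₁ (ladder-track hub rung0 _ ≤-refl)

    -- s⁺⁺ has a ladder of length #s+2, so its image needs one as well
    hash-mono : ∀ {s s′} → to F (plus2 s) ≡ plus2 s′ → # s ≤ # s′
    hash-mono {s} {s′} hub with rung0-image hub (# s + 2) ≤-refl
    ... | i′ , q′ , rung0 = +-cancelʳ-≤ 2 (# s) (# s′) (≤-trans (arm-length hub rung0) q′)

    leaf-track : ∀ {u u′ s m m′} → to F (node s) ≡ node s →
      to F (leaf u s m 0 z≤n) ≡ leaf u′ s m′ 0 z≤n →
      ∀ k (b : k ≤ top u) → Σ (k ≤ top u′) λ b′ →
        to F (leafDown u s m k b) ≡ leafDown u′ s m′ k b′ × to F (leaf u s m k b) ≡ leaf u′ s m′ k b′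
    leaf-track root leaf0 zero z≤n = z≤n , root , leaf0
    leaf-track {u} {u′} {s} {m} root leaf0 (suc k) b with leaf-track root leaf0 k (<⇒≤ b)
    ... | b′ , down , here with nbr-leaf (maps≡ F here refl (inj₁ (e-leaf u s m m k (<⇒≤ b) b)))
    ...   | inj₁ up↦down              = ⊥-elim (leaf-up≢down (injective F (trans up↦down (sym down))))
    ...   | inj₂ (inj₁ (b″ , up↦up))  = b″ , trans here (leaf-≡ refl refl) , up↦up
    ...   | inj₂ (inj₂ (k≡fork , up↦one)) =
      -- the preimage of the pendant 0^{2θ(u′)+2}⁀1 would end the path at an odd length
      ⊥-elim (odd≢even (θ′ u′) (θ′ u) (trans (cong suc (sym k≡fork))
        (pendant-leaf-at-top (reflect deg1-invariant F (subst Deg1 (sym up↦one) leafOne-pendant)))))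

    θ-mono : ∀ {u u′ s m m′} → to F (node s) ≡ node s →
      to F (leaf u s m 0 z≤n) ≡ leaf u′ s m′ 0 z≤n → θ′ u ≤ θ′ u′
    θ-mono {u} {u′} root leaf0 =
      *-cancelˡ-≤ 2 (+-cancelʳ-≤ 4 (2 * θ′ u) (2 * θ′ u′) (proj₁ (leaf-track root leaf0 (top u) ≤-refl)))

  -- Every automorphism fixes every vertex.  The inequalities from Tracking,
  -- applied to F and to F⁻¹, become equalities.
  module Fixed (F : Automorphism) where

    module Fwd = Tracking F
    module Bwd = Tracking (F ⁻¹)

    plus2-fixed : ∀ s → to F (plus2 s) ≡ plus2 s
    plus2-fixed s with Fwd.plus2-image s
    ... | s′ , hub = trans hub (cong plus2 (sym (↔-injective hash
                       (≤-antisym (Fwd.hash-mono hub) (Bwd.hash-mono (inverse-maps F hub))))))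

    ladder-fixed : ∀ s i j p q → to F (ladder s i j p q) ≡ ladder s i j p q
    ladder-fixed s i j p q with Fwd.rung0-image (plus2-fixed s) i q
    ... | i′ , q′ , rung0 =
      trans (proj₂ (proj₂ (Fwd.ladder-track hub rung0 j p))) (ladder-≡ (sym i≡i′) refl)
      where
      hub : to F (plus2 s) ≡ plus2 s
      hub = plus2-fixed s
      i≡i′ : i ≡ i′
      i≡i′ = ≤-antisym (Fwd.arm-length hub rung0) (Bwd.arm-length (inverse-maps F hub) (inverse-maps F rung0))

    plus-fixed : ∀ s → to F (plus s) ≡ plus s
    plus-fixed s = fixed-neighbour F (plus2-fixed s) (inj₂ (e-plus2 s)) others
      where
      others : ∀ {w} → E (plus2 s) w → w ≡ plus s ⊎ to F w ≡ w
      others e with nbr-plus2 e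
      ... | inj₁ eq             = inj₁ eq
      ... | inj₂ (i , q , refl) = inj₂ (ladder-fixed s i 0 z≤n q)

    node-fixed : ∀ s → to F (node s) ≡ node s
    node-fixed s = fixed-neighbour F (plus-fixed s) (inj₂ (e-plus s)) others
      where
      others : ∀ {w} → E (plus s) w → w ≡ node s ⊎ to F w ≡ w
      others e with nbr-plus e
      ... | inj₁ eq   = inj₁ eq
      ... | inj₂ refl = inj₂ (plus2-fixed s)

    star-fixed : ∀ s n → to F (star s n) ≡ star s n
    star-fixed s n = star-unique (maps≡ F (node-fixed s) refl (inj₁ (e-star₁ s n)))
                                 (maps≡ F refl (node-fixed (s ∷ʳ n)) (inj₁ (e-star₂ s n)))

    leaf0-image : ∀ u s m → Σ (List Bool) λ u′ → Σ (mem T u′ s ≡ true) λ m′ →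
                  to F (leaf u s m 0 z≤n) ≡ leaf u′ s m′ 0 z≤n
    leaf0-image u s m with nbr-node (maps≡ F (node-fixed s) refl (inj₂ (e-root u s m z≤n)))
    ... | inj₁ (s′ , n , eq) = contradiction (injective F (trans eq (sym (star-fixed s′ n)))) λ ()
    ... | inj₂ (inj₁ eq)     = contradiction (injective F (trans eq (sym (plus-fixed s)))) λ ()
    ... | inj₂ (inj₂ image)  = image

    leaf-fixed : ∀ u s m k b → to F (leaf u s m k b) ≡ leaf u s m k b
    leaf-fixed u s m k b with leaf0-image u s m
    ... | u′ , m′ , leaf0 =
      trans (proj₂ (proj₂ (Fwd.leaf-track root leaf0 k b))) (leaf-≡ (sym u≡u′) refl)
      where
      root : to F (node s) ≡ node s
      root = node-fixed s
      u≡u′ : u ≡ u′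
      u≡u′ = ↔-injective θ (≤-antisym (Fwd.θ-mono root leaf0)
                                      (Bwd.θ-mono (inverse-maps F root) (inverse-maps F leaf0)))

    leafDown-fixed : ∀ u s m k b → to F (leafDown u s m k b) ≡ leafDown u s m k b
    leafDown-fixed u s m zero    b = node-fixed s
    leafDown-fixed u s m (suc k) b = leaf-fixed u s m k (<⇒≤ b)

    leafOne-fixed : ∀ u s m → to F (leafOne u s m) ≡ leafOne u s m
    leafOne-fixed u s m =
      fixed-neighbour F (leaf-fixed u s m (fork u) (fork≤top u)) (inj₁ (e-one u s m m (fork≤top u))) others
      where
      others : ∀ {w} → E (leaf u s m (fork u) (fork≤top u)) w → w ≡ leafOne u s m ⊎ to F w ≡ w
      others e with nbr-leaf e
      ... | inj₁ refl               = inj₂ (leafDown-fixed u s m (fork u) (fork≤top u))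
      ... | inj₂ (inj₁ (b , refl))  = inj₂ (leaf-fixed u s m _ b)
      ... | inj₂ (inj₂ (_ , eq))    = inj₁ eq

  rigid : Rigid
  rigid F (node s)           = Fixed.node-fixed F s
  rigid F (star s n)         = Fixed.star-fixed F s n
  rigid F (plus s)           = Fixed.plus-fixed F s
  rigid F (plus2 s)          = Fixed.plus2-fixed F s
  rigid F (ladder s i j p q) = Fixed.ladder-fixed F s i j p q
  rigid F (leaf u s m k b)   = Fixed.leaf-fixed F u s m k b
  rigid F (leafOne u s m)    = Fixed.leafOne-fixed F u s m

lemma3p3 : (hash : List ℕ ↔ ℕ) (θ : List Bool ↔ ℕ) → LengthMonotone θ →
    (T : NormalTree) (c : ℕ ↔ Vertex hash θ T) →
    (p q : S∞) → ¬ SamePerm p q →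
    ¬ SameStructure (jL p (G hash θ T c)) (jL q (G hash θ T c))
lemma3p3 hash θ _ T c p q p≢q same = p≢q (rigid⇒free (G hash θ T c) coded-rigid p q same)
  where
  coded-rigid : Graph.Rigid (G hash θ T c)
  coded-rigid = rigid-recode (Edge hash θ T) c (Rigidity.rigid hash θ T)
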